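{- Let $M$ be the complement of the graph on vertex set $\{1,\dots,7\}$ whose edges are $\{1,2\},\{3,4\},\{5,6\}$. Let $G$ be a graph with a vertex partition $V(G)=X_1\cup\dots\cup X_8$ such that $X_1,X_3,X_5,X_7$ are cliques, $X_2,X_4,X_6,X_8$ are independent sets, and there are no edges between $X_i$ and $X_j$ unless $|i-j|\equiv\pm1\pmod 8$. Then (1) every induced copy of the cycle $C_8$ in $G$ is of the form $x_1x_2\dots x_8x_1$ with $x_i\in X_i$ for every $i$; and (2) $G$ contains no induced copy of $M$.
   Context: $C_8$ denotes the cycle on $8$ vertices. -}

module Defs where

open import Data.Nat using (ℕ; _+_; _∸_; _%_)
open import Data.Fin using (Fin; toℕ)
open import Data.Product using (_×_; ∃; Σ)
open import Data.Sum using (_⊎_)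
open import Data.Empty using (⊥)
open import Relation.Nullary using (¬_)
open import Relation.Binary.PropositionalEquality using (_≡_)
open import Function.Bundles using (_⇔_)

record Graph : Set₁ where
  field
    V     : Set
    Adj   : V → V → Set
    sym   : ∀ {u v} → Adj u v → Adj v u
    irrefl : ∀ {v} → ¬ Adj v v

-- Adjacency in the cycle C_8 on vertices 0..7 (0-based version of 1..8).
C8Adj : Fin 8 → Fin 8 → Set
C8Adj i j = (toℕ j ≡ (toℕ i + 1) % 8) ⊎ (toℕ i ≡ (toℕ j + 1) % 8)

Cyclic±1 : Fin 8 → Fin 8 → Set
Cyclic±1 = C8Adj

-- The graph M: complement of the graph on {0..6} with edges {0,1},{2,3},{4,5}
-- (0-based version of {1,2},{3,4},{5,6} on {1..7}).
MatchEdge : Fin 7 → Fin 7 → Set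
MatchEdge i j =
  ((toℕ i ≡ 0 × toℕ j ≡ 1) ⊎ (toℕ i ≡ 1 × toℕ j ≡ 0)) ⊎
  (((toℕ i ≡ 2 × toℕ j ≡ 3) ⊎ (toℕ i ≡ 3 × toℕ j ≡ 2)) ⊎
   ((toℕ i ≡ 4 × toℕ j ≡ 5) ⊎ (toℕ i ≡ 5 × toℕ j ≡ 4)))

MAdj : Fin 7 → Fin 7 → Set
MAdj i j = ¬ (i ≡ j) × ¬ MatchEdge i j

record InducedCopy (G : Graph) (n : ℕ) (HAdj : Fin n → Fin n → Set) : Set where
  open Graph G
  field
    emb    : Fin n → V
    inj    : ∀ i j → emb i ≡ emb j → i ≡ j
    adjIff : ∀ i j → Adj (emb i) (emb j) ⇔ HAdj i j

-- The structural hypotheses on a partition part : V → Fin 8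
-- (part v = k means v ∈ X_{k+1}).  X_1,X_3,X_5,X_7 = parts 0,2,4,6 are cliques,
-- X_2,X_4,X_6,X_8 = parts 1,3,5,7 are independent sets.
IsCliquePart : Fin 8 → Set
IsCliquePart k = (toℕ k % 2) ≡ 0

record GoodPartition (G : Graph) (part : Graph.V G → Fin 8) : Set where
  open Graph G
  field
    clique : ∀ u v → part u ≡ part v → IsCliquePart (part u) → ¬ (u ≡ v) → Adj u v
    indep  : ∀ u v → part u ≡ part v → ¬ IsCliquePart (part u) → ¬ Adj u v
    across : ∀ u v → ¬ (part u ≡ part v) → Adj u v → Cyclic±1 (part u) (part v)

-- "The copy is x_1 x_2 ... x_8 x_1 with x_i ∈ X_i": the map i ↦ part (emb i)
-- is a symmetry of C_8 (a rotation or a reflection), i.e. traversing the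
-- copy's cycle in a suitable direction from a suitable start visits
-- X_1, X_2, ..., X_8 in order.
PartsInOrder : (Fin 8 → Fin 8) → Set
PartsInOrder p =
  Σ ℕ λ k → (∀ i → toℕ (p i) ≡ (toℕ i + k) % 8)
          ⊎ (∀ i → toℕ (p i) ≡ (k + (8 ∸ toℕ i)) % 8)

module Submission where

-- Which part a vertex lies in, together with adjacency, is constrained only pairwise: two
-- vertices in the same part are adjacent iff that part is a clique, and vertices of
-- different parts can be adjacent only if the parts are cyclically consecutive. An induced
-- copy of a graph H therefore yields a labelling of V(H) by the eight parts obeying these
-- rules for every pair, and both claims are statements about such labellings of C₈ and of
-- M, which are finitely many and are enumerated by a pruned exhaustive search.

open import Defs
open import Data.Bool using (Bool; true; false; T; not; _∧_; _∨_)
open import Data.Bool.ListAction using (all)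
open import Data.Bool.Properties using (T-∧)
open import Data.Fin using (Fin; zero; suc; toℕ; _≟_)
open import Data.Fin.Properties using (suc-injective; any?; all?)
open import Data.List using (List; allFin)
open import Data.List.Membership.Propositional using (_∈_)
open import Data.List.Membership.Propositional.Properties using (∈-allFin)
open import Data.List.Relation.Unary.All using (lookup)
open import Data.List.Relation.Unary.All.Properties using (all⁺)
open import Data.Nat using (ℕ; _+_; _∸_; _%_)
import Data.Nat as ℕ
open import Data.Product using (_×_; _,_; ∃)
open import Data.Sum using (_⊎_; inj₁; inj₂)
open import Data.Vec using (Vec; []; _∷_; tabulate)
import Data.Vec as Vec
open import Data.Vec.Properties using (lookup∘tabulate)
open import Function using (_∘_; const)
open import Function.Bundles using (_⇔_; Equivalence)
open import Relation.Binary.Definitions using (Decidable)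
open import Relation.Binary.PropositionalEquality using (_≡_; _≢_; subst)
open import Relation.Nullary using (¬_; Dec; ¬?)
open import Relation.Nullary.Decidable using (⌊_⌋; _×-dec_; _⊎-dec_; _→-dec_; fromWitness; toWitness)

Permitted : Set → Fin 8 → Fin 8 → Set
Permitted A x y =
  (x ≡ y → IsCliquePart x → A) × (x ≡ y → ¬ IsCliquePart x → ¬ A) × (x ≢ y → A → Cyclic±1 x y)

isCliquePart? : ∀ x → Dec (IsCliquePart x)
isCliquePart? x = toℕ x % 2 ℕ.≟ 0

cyclic±1? : Decidable Cyclic±1
cyclic±1? x y = (toℕ y ℕ.≟ (toℕ x + 1) % 8) ⊎-dec (toℕ x ℕ.≟ (toℕ y + 1) % 8)

permitted? : ∀ {A} → Dec A → ∀ x y → Dec (Permitted A x y)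
permitted? A? x y =
  (x ≟ y →-dec isCliquePart? x →-dec A?) ×-dec
  (x ≟ y →-dec ¬? (isCliquePart? x) →-dec ¬? A?) ×-dec
  (¬? (x ≟ y) →-dec A? →-dec cyclic±1? x y)

permitted-⇔ : ∀ {A B x y} → A ⇔ B → Permitted A x y → Permitted B x y
permitted-⇔ A⇔B (clique , indep , across) =
  (λ x≡y c → Equivalence.to A⇔B (clique x≡y c)) ,
  (λ x≡y i b → indep x≡y i (Equivalence.from A⇔B b)) ,
  (λ x≢y b → across x≢y (Equivalence.from A⇔B b))

Admissible : ∀ {n} → (Fin n → Fin n → Set) → (Fin n → Fin 8) → Set
Admissible H p = ∀ i j → i ≢ j → Permitted (H i j) (p i) (p j)

inducedCopy-admissible : ∀ {G part n H} → GoodPartition G part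
  → (c : InducedCopy G n H) → Admissible H (part ∘ InducedCopy.emb c)
inducedCopy-admissible good c i j i≢j =
  permitted-⇔ (adjIff i j)
    ( (λ same isClique → clique (emb i) (emb j) same isClique (i≢j ∘ inj i j))
    , indep (emb i) (emb j)
    , across (emb i) (emb j))
  where
  open GoodPartition good
  open InducedCopy c

-- Labels vertex 0 first; its pairwise constraints with the still unlabelled vertices
-- are folded into their unary filter `allowed`, which prunes the search early. Goals read
-- labellings as vectors because `tabulate p` unfolds definitionally to `p zero ∷ tabulate (p ∘ suc)`.
module ExhaustiveSearch {L : Set} (labels : List L) (complete : ∀ x → x ∈ labels) where

  exhaustive : ∀ n → (Fin n → L → Bool) → (Fin n → Fin n → L → L → Bool) → (Vec L n → Bool) → Bool
  exhaustive ℕ.zero    allowed ok goal = goal []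
  exhaustive (ℕ.suc n) allowed ok goal = all branch labels
    where
    branch : L → Bool
    branch x = not (allowed zero x) ∨
      exhaustive n (λ i y → allowed (suc i) y ∧ ok zero (suc i) x y) (λ i j → ok (suc i) (suc j)) (goal ∘ (x ∷_))

  exhaustive-sound : ∀ n allowed ok goal → T (exhaustive n allowed ok goal)
    → ∀ p → (∀ i → T (allowed i (p i))) → (∀ i j → i ≢ j → T (ok i j (p i) (p j)))
    → T (goal (tabulate p))
  exhaustive-sound ℕ.zero    allowed ok goal t p _ _ = t
  exhaustive-sound (ℕ.suc n) allowed ok goal t p allowed-p ok-p =
    exhaustive-sound n _ _ _ (modusPonens (lookup (all⁺ _ labels t) (complete (p zero))) (allowed-p zero))
      (p ∘ suc)
      (λ i → Equivalence.from T-∧ (allowed-p (suc i) , ok-p zero (suc i) λ ()))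
      (λ i j i≢j → ok-p (suc i) (suc j) (i≢j ∘ suc-injective))
    where
    modusPonens : ∀ {a b} → T (not a ∨ b) → T a → T b
    modusPonens {true} t _ = t

open ExhaustiveSearch (allFin 8) ∈-allFin

admissibleSearch : ∀ {n} {H : Fin n → Fin n → Set} → Decidable H → (Vec (Fin 8) n → Bool) → Bool
admissibleSearch {n} H? = exhaustive n (λ _ _ → true) (λ i j x y → ⌊ permitted? (H? i j) x y ⌋)

admissibleSearch-sound : ∀ {n H} (H? : Decidable H) goal → T (admissibleSearch H? goal)
  → ∀ {p} → Admissible H p → T (goal (tabulate p))
admissibleSearch-sound {n} H? goal t {p} adm =
  exhaustive-sound n _ _ goal t p (const _) (λ i j i≢j → fromWitness (adm i j i≢j))

RotationBy ReflectionBy : ℕ → (Fin 8 → Fin 8) → Set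
RotationBy   k p = ∀ i → toℕ (p i) ≡ (toℕ i + k) % 8
ReflectionBy k p = ∀ i → toℕ (p i) ≡ (k + (8 ∸ toℕ i)) % 8

partsInOrder? : ∀ p → Dec (∃ λ (k : Fin 8) → RotationBy (toℕ k) p ⊎ ReflectionBy (toℕ k) p)
partsInOrder? p = any? λ k →
  all? (λ i → toℕ (p i) ℕ.≟ (toℕ i + toℕ k) % 8) ⊎-dec all? (λ i → toℕ (p i) ℕ.≟ (toℕ k + (8 ∸ toℕ i)) % 8)

partsInOrder-cong : ∀ {p q} → (∀ i → p i ≡ q i) → PartsInOrder p → PartsInOrder q
partsInOrder-cong p≗q (k , inj₁ rot) = k , inj₁ λ i → subst (λ x → toℕ x ≡ _) (p≗q i) (rot i)
partsInOrder-cong p≗q (k , inj₂ ref) = k , inj₂ λ i → subst (λ x → toℕ x ≡ _) (p≗q i) (ref i)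

admissible-C₈-partsInOrder : ∀ {p} → Admissible C8Adj p → PartsInOrder p
admissible-C₈-partsInOrder {p} adm =
  let k , inOrder = toWitness {a? = partsInOrder? (Vec.lookup (tabulate p))}
                      (admissibleSearch-sound cyclic±1? (⌊_⌋ ∘ partsInOrder? ∘ Vec.lookup) _ adm)
  in partsInOrder-cong (lookup∘tabulate p) (toℕ k , inOrder)

matchedPair? : ∀ a b (i j : Fin 7) → Dec ((toℕ i ≡ a × toℕ j ≡ b) ⊎ (toℕ i ≡ b × toℕ j ≡ a))
matchedPair? a b i j = (toℕ i ℕ.≟ a ×-dec toℕ j ℕ.≟ b) ⊎-dec (toℕ i ℕ.≟ b ×-dec toℕ j ℕ.≟ a)

mAdj? : Decidable MAdj
mAdj? i j = ¬? (i ≟ j) ×-dec ¬? (matchedPair? 0 1 i j ⊎-dec matchedPair? 2 3 i j ⊎-dec matchedPair? 4 5 i j)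

no-admissible-M : ∀ {p} → ¬ Admissible MAdj p
no-admissible-M = admissibleSearch-sound mAdj? (const false) _

lemma3p4 : (G : Graph) (part : Graph.V G → Fin 8) → GoodPartition G part
    → ((c : InducedCopy G 8 C8Adj) → PartsInOrder (part ∘ InducedCopy.emb c))
      × ¬ InducedCopy G 7 MAdj
lemma3p4 G part good =
  (λ c → admissible-C₈-partsInOrder (inducedCopy-admissible good c)) ,
  (λ c → no-admissible-M (inducedCopy-admissible good c))
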